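{- Let $G=(K\uplus S,E)$ be a split graph and let $D$ be a D$2$DS of $G$. (a) For every $u\in D\cap K$ and $v\in K\setminus D$, the set $(D\setminus\{u\})\cup\{v\}$ is a D$2$DS of $G$. (b) For every $u\in D\cap S$ and $v\in K\setminus D$, the set $(D\setminus\{u\})\cup\{v\}$ is a D$2$DS of $G$. (c) For every $u\in D\cap K$ and $v\in S\setminus D$, the set $(D\setminus\{u\})\cup\{v\}$ is a D$2$DS of $G$ provided $(D\cap K)\setminus\{u\}\ne\emptyset$.
   Context: Graphs are finite, simple, undirected and connected. A split graph $G=(K\uplus S,E)$ has vertex set partitioned into a clique $K$ and an independent set $S$. A D$2$DS (distance-2 dominating set) of $G$ is a set $D\subseteq V(G)$ such that every vertex is at distance at most $2$ from some vertex of $D$. -}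

module Defs where

open import Data.Nat using (ℕ)
open import Data.Fin using (Fin)
open import Data.Fin.Subset using (Subset; _∈_; _∉_; ∁)
open import Data.Product using (Σ; _×_; ∃)
open import Data.Sum using (_⊎_)
open import Data.Empty using (⊥)
open import Relation.Nullary using (¬_)
open import Relation.Binary.PropositionalEquality using (_≡_)

record Graph (n : ℕ) : Set₁ where
  field
    Adj       : Fin n → Fin n → Set
    Adj-sym   : ∀ {x y} → Adj x y → Adj y x
    Adj-irrefl : ∀ {x} → ¬ Adj x x
open Graph public

data Reachable {n : ℕ} (G : Graph n) : Fin n → Fin n → Set where
  here : ∀ {x} → Reachable G x x
  step : ∀ {x y z} → Adj G x y → Reachable G y z → Reachable G x z

Connected : {n : ℕ} → Graph n → Set
Connected G = ∀ x y → Reachable G x y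

-- G is a split graph with clique K and independent set S = ∁ K
-- (so V(G) = K ⊎ S is a partition).
IsSplit : {n : ℕ} → Graph n → Subset n → Set
IsSplit G K =
  (∀ x y → x ∈ K → y ∈ K → ¬ x ≡ y → Adj G x y) ×
  (∀ x y → x ∈ ∁ K → y ∈ ∁ K → ¬ Adj G x y)

Dist≤2 : {n : ℕ} → Graph n → Fin n → Fin n → Set
Dist≤2 G x y = x ≡ y ⊎ Adj G x y ⊎ ∃ λ z → Adj G x z × Adj G z y

IsD2DS : {n : ℕ} → Graph n → Subset n → Set
IsD2DS {n} G D = ∀ (w : Fin n) → ∃ λ d → d ∈ D × Dist≤2 G d w

-- Every vertex within distance 2 of a clique vertex, and (in a connected graph)
-- every vertex within distance 2 of a vertex of S, is equal or adjacent to some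
-- vertex of K; and every vertex of the clique K is within distance 2 of all such
-- vertices. Hence any vertex of K reaches at distance 2 everything that the
-- removed vertex u reached, and substituting it for u keeps D distance-2
-- dominating. In (c) the substitute is a remaining vertex of D ∩ K, not v.
module Submission where

open import Defs
open import Data.Nat using (ℕ)
open import Data.Fin using (Fin)
open import Data.Fin.Subset using (Subset; _∈_; _∉_; ∁; _∩_; _∪_; _─_; _-_; ⁅_⁆; Nonempty; inside; outside)
open import Data.Fin.Subset.Properties using (_∈?_; x∈p⇒x∉∁p; x∉p⇒x∈∁p; x∈p∪q⁺; x∈⁅x⁆; x∈p∧x≢y⇒x∈p-y; p─q⊆p; x∈p∩q⁻; x∉⁅y⁆⇒x≢y)
open import Data.Fin.Properties using (_≟_)
open import Data.Vec using (_∷_; here; there)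
open import Data.Product using (_×_; _,_; ∃; proj₁; proj₂)
open import Data.Sum using (_⊎_; inj₁; inj₂)
open import Relation.Nullary using (yes; no)
open import Relation.Nullary.Negation using (contradiction)
open import Relation.Binary.PropositionalEquality using (_≡_; _≢_; refl)

x∈p─q⇒x∉q : ∀ {n} {x : Fin n} (p q : Subset n) → x ∈ p ─ q → x ∉ q
x∈p─q⇒x∉q (inside ∷ p) (outside ∷ q) here ()
x∈p─q⇒x∉q (_ ∷ p)      (_ ∷ q)       (there x∈) (there x∈q) = x∈p─q⇒x∉q p q x∈ x∈q

Reachable⇒∃-neighbour : ∀ {n} {G : Graph n} {x y} → Reachable G x y → x ≢ y →
                        ∃ λ z → Adj G x z
Reachable⇒∃-neighbour here       x≢x = contradiction refl x≢x
Reachable⇒∃-neighbour (step a _) _   = _ , a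

_Covers_ : ∀ {n} → Graph n → Fin n → Fin n → Set
(G Covers y) u = ∀ w → Dist≤2 G u w → Dist≤2 G y w

IsD2DS-exchange : ∀ {n} (G : Graph n) (D : Subset n) (u v y : Fin n) → IsD2DS G D →
                  y ∈ (D - u) ∪ ⁅ v ⁆ → (G Covers y) u →
                  IsD2DS G ((D - u) ∪ ⁅ v ⁆)
IsD2DS-exchange G D u v y dom y∈D′ y-covers w with dom w
... | d , d∈D , d-w with d ≟ u
...   | yes refl = y , y∈D′ , y-covers w d-w
...   | no  d≢u  = d , x∈p∪q⁺ (inj₁ (x∈p∧x≢y⇒x∈p-y d∈D d≢u)) , d-w

module SplitGraph {n : ℕ} (G : Graph n) (K : Subset n) (split : IsSplit G K) where

  NearClique : Fin n → Set
  NearClique w = ∃ λ z → z ∈ K × (w ≡ z ⊎ Adj G z w)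

  neighbour-of-independent∈K : ∀ {x y} → x ∈ ∁ K → Adj G x y → y ∈ K
  neighbour-of-independent∈K {x} {y} x∈S a with y ∈? K
  ... | yes y∈K = y∈K
  ... | no  y∉K = contradiction a (proj₂ split x y x∈S (x∉p⇒x∈∁p y∉K))

  NearClique⇒Dist≤2 : ∀ {y w} → y ∈ K → NearClique w → Dist≤2 G y w
  NearClique⇒Dist≤2 {y} y∈K (z , z∈K , w≡z⊎z-w) with z ≟ y | w≡z⊎z-w
  ... | yes refl | inj₁ refl = inj₁ refl
  ... | yes refl | inj₂ a    = inj₂ (inj₁ a)
  ... | no  z≢y  | inj₁ refl = inj₂ (inj₁ (proj₁ split y z y∈K z∈K (λ { refl → z≢y refl })))
  ... | no  z≢y  | inj₂ a    = inj₂ (inj₂ (z , proj₁ split y z y∈K z∈K (λ { refl → z≢y refl }) , a))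

  Dist≤2-from-clique⇒NearClique : ∀ {u w} → u ∈ K → Dist≤2 G u w → NearClique w
  Dist≤2-from-clique⇒NearClique {u} u∈K (inj₁ refl)         = u , u∈K , inj₁ refl
  Dist≤2-from-clique⇒NearClique {u} u∈K (inj₂ (inj₁ a))     = u , u∈K , inj₂ a
  Dist≤2-from-clique⇒NearClique {w = w} _ (inj₂ (inj₂ (z , _ , a))) with z ∈? K
  ... | yes z∈K = z , z∈K , inj₂ a
  ... | no  z∉K = w , neighbour-of-independent∈K (x∉p⇒x∈∁p z∉K) a , inj₁ refl

  -- Connectivity is needed only when w = u: an isolated u ∈ S would be near no vertex of K.
  Dist≤2-from-independent⇒NearClique : Connected G → ∀ {u y w} → u ∈ ∁ K → y ∈ K →
                                       Dist≤2 G u w → NearClique w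
  Dist≤2-from-independent⇒NearClique conn {u} {y} u∈S y∈K (inj₁ refl)
    with Reachable⇒∃-neighbour (conn u y) (λ { refl → x∈p⇒x∉∁p y∈K u∈S })
  ... | z , a = z , neighbour-of-independent∈K u∈S a , inj₂ (Adj-sym G a)
  Dist≤2-from-independent⇒NearClique _ {w = w} u∈S _ (inj₂ (inj₁ a)) =
    w , neighbour-of-independent∈K u∈S a , inj₁ refl
  Dist≤2-from-independent⇒NearClique _ u∈S _ (inj₂ (inj₂ (z , a , b))) =
    z , neighbour-of-independent∈K u∈S a , inj₂ b

  clique-Covers-clique : ∀ {u y} → u ∈ K → y ∈ K → (G Covers y) u
  clique-Covers-clique u∈K y∈K w u-w =
    NearClique⇒Dist≤2 y∈K (Dist≤2-from-clique⇒NearClique u∈K u-w)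

  clique-Covers-independent : Connected G → ∀ {u y} → u ∈ ∁ K → y ∈ K → (G Covers y) u
  clique-Covers-independent conn u∈S y∈K w u-w =
    NearClique⇒Dist≤2 y∈K (Dist≤2-from-independent⇒NearClique conn u∈S y∈K u-w)

lemma6 : {n : ℕ} (G : Graph n) (K : Subset n) → Connected G → IsSplit G K →
         (D : Subset n) → IsD2DS G D →
         ((u v : Fin n) → u ∈ D → u ∈ K → v ∈ K → v ∉ D →
            IsD2DS G ((D - u) ∪ ⁅ v ⁆)) ×
         ((u v : Fin n) → u ∈ D → u ∈ ∁ K → v ∈ K → v ∉ D →
            IsD2DS G ((D - u) ∪ ⁅ v ⁆)) ×
         ((u v : Fin n) → u ∈ D → u ∈ K → v ∈ ∁ K → v ∉ D →
            Nonempty ((D ∩ K) - u) →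
            IsD2DS G ((D - u) ∪ ⁅ v ⁆))
lemma6 G K conn split D dom =
    (λ u v _ u∈K v∈K _ → exchange u v v (new v) (clique-Covers-clique u∈K v∈K))
  , (λ u v _ u∈S v∈K _ → exchange u v v (new v) (clique-Covers-independent conn u∈S v∈K))
  , λ { u v _ u∈K _ _ (x , x∈DK-u) →
        let x∈D , x∈K = x∈p∩q⁻ D K (p─q⊆p (D ∩ K) ⁅ u ⁆ x∈DK-u)
            x≢u = x∉⁅y⁆⇒x≢y (x∈p─q⇒x∉q (D ∩ K) ⁅ u ⁆ x∈DK-u)
        in exchange u v x (x∈p∪q⁺ (inj₁ (x∈p∧x≢y⇒x∈p-y x∈D x≢u)))
                    (clique-Covers-clique u∈K x∈K) }
  where
  open SplitGraph G K split
  exchange : ∀ u v y → y ∈ (D - u) ∪ ⁅ v ⁆ → (G Covers y) u → IsD2DS G ((D - u) ∪ ⁅ v ⁆)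
  exchange u v y = IsD2DS-exchange G D u v y dom
  new : ∀ {u} v → v ∈ (D - u) ∪ ⁅ v ⁆
  new v = x∈p∪q⁺ (inj₂ (x∈⁅x⁆ v))
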